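{- Let $G=(V,E)$ be a loopless (multi)graph and $w:V\to\mathbb{R}$ a weight vector. Let $\hat d$ be the output of \textsc{Weighted-Greedy}$(G,w)$ and let $d^*_w$ be an orientation minimizing $\langle w,d\rangle$ over all orientations $d$ of $G$. Then $$\langle w,\hat d\rangle\le\langle w,d^*_w\rangle+\sum_{u\in V}\deg_G(u)^2.$$ In particular, the additive error does not depend on $w$.
   Context: An orientation vector: assign to each edge $uv$ two numbers $x_{uv},x_{vu}\ge0$ with $x_{uv}+x_{vu}=1$; the induced vector $d\in\mathbb{R}^V$ is $d_u=\sum_{v: uv\in E}x_{uv}$; $d$ is called an orientation if it is induced by such an $x$. \textsc{Weighted-Greedy}$(G,w)$: set $G'=G$ and $\hat d(u)=0$ for all $u$; while $G'$ has more than one vertex, pick $u\in V(G')$ minimizing $w(u)+\deg_{G'}(u)$, set $\hat d(u)=\deg_{G'}(u)$, and delete $u$ from $G'$; return $\hat d$.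
   Formalization: The weight vector w takes values in ℚ rather than ℝ, and the numbers $x_{uv}$ defining orientations are rational, so $d^*_w$ is taken over rational orientations. -}

module Defs where

open import Data.Nat as ℕ using (ℕ; zero; suc)
open import Data.Fin using (Fin; zero; suc; toℕ)
open import Data.Fin.Properties using (_≟_)
open import Data.Product using (_×_; _,_; proj₁; proj₂; ∃)
open import Data.Bool using (Bool; true; false; if_then_else_; _∧_; _∨_)
open import Data.Integer using (+_)
open import Data.Rational using (ℚ; _+_; _*_; _-_; _≤_; 0ℚ; 1ℚ; _/_)
open import Relation.Nullary using (¬_)
open import Relation.Nullary.Decidable using (⌊_⌋)
open import Relation.Binary.PropositionalEquality using (_≡_)
open import Function.Definitions using (Injective)

Graph : ℕ → ℕ → Set
Graph n m = Fin m → Fin n × Fin n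

Loopless : ∀ {n m} → Graph n m → Set
Loopless E = ∀ e → ¬ (proj₁ (E e) ≡ proj₂ (E e))

ℕtoℚ : ℕ → ℚ
ℕtoℚ k = (+ k) / 1

Σℚ : ∀ {k} → (Fin k → ℚ) → ℚ
Σℚ {zero} f = 0ℚ
Σℚ {suc k} f = f zero + Σℚ (λ i → f (suc i))

Σℕ : ∀ {k} → (Fin k → ℕ) → ℕ
Σℕ {zero} f = 0
Σℕ {suc k} f = f zero ℕ.+ Σℕ (λ i → f (suc i))

⟪_,_⟫ : ∀ {n} → (Fin n → ℚ) → (Fin n → ℚ) → ℚ
⟪ w , d ⟫ = Σℚ (λ u → w u * d u)

_==_ : ∀ {n} → Fin n → Fin n → Bool
a == b = ⌊ a ≟ b ⌋

deg : ∀ {n m} → Graph n m → Fin n → ℕ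
deg E u = Σℕ (λ e → (if proj₁ (E e) == u then 1 else 0)
                  ℕ.+ (if proj₂ (E e) == u then 1 else 0))

-- Orientations: x e ∈ [0,1] is x_{ab} for the edge e = (a,b), and
-- x_{ba} = 1 - x e.  The induced vector d_u = Σ_{edges at u} x_{u·}.
ValidFrac : ∀ {m} → (Fin m → ℚ) → Set
ValidFrac x = ∀ e → (0ℚ ≤ x e) × (x e ≤ 1ℚ)

induced : ∀ {n m} → Graph n m → (Fin m → ℚ) → Fin n → ℚ
induced E x u = Σℚ (λ e → (if proj₁ (E e) == u then x e else 0ℚ)
                        + (if proj₂ (E e) == u then 1ℚ - x e else 0ℚ))

IsOrientation : ∀ {n m} → Graph n m → (Fin n → ℚ) → Set
IsOrientation {n} {m} E d =
  ∃ λ (x : Fin m → ℚ) → ValidFrac x × (∀ u → d u ≡ induced E x u)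

-- A run of Weighted-Greedy is described by its elimination order:
-- pos v = the step at which v is deleted (pos injective).  The graph G'
-- at step i consists of the vertices v with i ≤ pos v.
alive : ∀ {n} → (Fin n → Fin n) → ℕ → Fin n → Bool
alive pos i v = ⌊ i ℕ.≤? toℕ (pos v) ⌋

-- degree of u in G' at step i (u assumed alive; loopless so each edge
-- at u contributes once, iff its other endpoint is alive)
degAt : ∀ {n m} → Graph n m → (Fin n → Fin n) → ℕ → Fin n → ℕ
degAt E pos i u =
  Σℕ (λ e → (if (proj₁ (E e) == u) ∧ alive pos i (proj₂ (E e)) then 1 else 0)
         ℕ.+ (if (proj₂ (E e) == u) ∧ alive pos i (proj₁ (E e)) then 1 else 0))

-- Greedy rule: the vertex deleted at step i minimizes w(v) + deg_{G'}(v)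
-- among the vertices of G'.  (The final remaining vertex trivially satisfies
-- it; its output value deg = 0 agrees with d̂ = 0 since G is loopless.)
IsGreedyRun : ∀ {n m} → Graph n m → (Fin n → ℚ) → (Fin n → Fin n) → Set
IsGreedyRun E w pos =
  Injective _≡_ _≡_ pos ×
  (∀ u v → toℕ (pos u) ℕ.≤ toℕ (pos v) →
     w u + ℕtoℚ (degAt E pos (toℕ (pos u)) u)
       ≤ w v + ℕtoℚ (degAt E pos (toℕ (pos u)) v))

greedyOut : ∀ {n m} → Graph n m → (Fin n → Fin n) → Fin n → ℚ
greedyOut E pos u = ℕtoℚ (degAt E pos (toℕ (pos u)) u)

{-# OPTIONS --safe #-}

-- Each edge uv contributes w(u) to ⟨w, d̂⟩, where u is the endpoint that Weighted-Greedy
-- deletes first, and x·w(u) + (1 - x)·w(v) to ⟨w, d⟩ for any orientation d.  When u is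
-- deleted v is still present, so the greedy choice gives
--   w(u) ≤ w(u) + deg'(u) ≤ w(v) + deg'(v) ≤ w(v) + deg(v),
-- hence w(u) exceeds the convex combination by at most deg(u) + deg(v).  Summing over the
-- edges, Σ_uv (deg(u) + deg(v)) = Σ_u deg(u)².

module Submission where

open import Defs
open import Data.Nat using (ℕ; _*_)
open import Data.Fin using (Fin)
open import Data.Rational using (ℚ; _+_; _≤_)

open import Algebra.Bundles using (CommutativeRing)
open import Data.Bool using (Bool; true; false; if_then_else_; _∧_)
import Data.Integer as ℤ
import Data.Integer.Properties as ℤ
open import Data.Fin as Fin using (zero; suc; toℕ)
open import Data.Fin.Properties using (toℕ-injective)
import Data.Nat as ℕ
import Data.Nat.Properties as ℕ
import Data.Nat.Coprimality as Coprime
open import Data.Product using (_,_; proj₁; proj₂)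
open import Data.Rational using (0ℚ; 1ℚ; mkℚ; _/_; _-_; -_; nonNegative)
  renaming (_*_ to _·_)
open import Data.Rational.Properties
open import Data.Rational.Solver using (module +-*-Solver)
open import Function.Base using (_∘_)
open import Relation.Binary.Definitions using (tri<; tri≈; tri>)
open import Relation.Binary.PropositionalEquality
  using (_≡_; _≢_; refl; sym; cong; cong₂; trans; subst; module ≡-Reasoning)
open import Relation.Nullary using (yes; no)
open import Relation.Nullary.Decidable using (dec-true; dec-false; isYes≗does)
open import Relation.Nullary.Negation using (contradiction)

open import Algebra.Properties.Semiring.Sum (CommutativeRing.semiring +-*-commutativeRing)
  using (sum; sum-cong-≗; ∑-distrib-+; ∑-comm; *-distribˡ-sum; sum-replicate-zero)

ℕtoℚ≡mkℚ : ∀ k → ℕtoℚ k ≡ mkℚ (ℤ.+ k) 0 (Coprime.sym (Coprime.1-coprimeTo k))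
ℕtoℚ≡mkℚ k = normalize-coprime (Coprime.sym (Coprime.1-coprimeTo k))

ℕtoℚ-+ : ∀ m n → ℕtoℚ (m ℕ.+ n) ≡ ℕtoℚ m + ℕtoℚ n
ℕtoℚ-+ m n rewrite ℕtoℚ≡mkℚ m | ℕtoℚ≡mkℚ n =
  sym (cong₂ (λ i j → (i ℤ.+ j) / 1) (ℤ.*-identityʳ (ℤ.+ m)) (ℤ.*-identityʳ (ℤ.+ n)))

ℕtoℚ-* : ∀ m n → ℕtoℚ (m * n) ≡ ℕtoℚ m · ℕtoℚ n
ℕtoℚ-* m n rewrite ℕtoℚ≡mkℚ m | ℕtoℚ≡mkℚ n = cong (_/ 1) (ℤ.pos-* m n)

0≤ℕtoℚ : ∀ k → 0ℚ ≤ ℕtoℚ k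
0≤ℕtoℚ k = nonNegative⁻¹ (ℕtoℚ k) {{normalize-nonNeg k 1}}

p≤p+q : ∀ {p q} → 0ℚ ≤ q → p ≤ p + q
p≤p+q {p} {q} 0≤q = subst (_≤ p + q) (+-identityʳ p) (+-monoʳ-≤ p 0≤q)

p≤q+p : ∀ {p q} → 0ℚ ≤ q → p ≤ q + p
p≤q+p {p} {q} 0≤q = subst (p ≤_) (+-comm p q) (p≤p+q 0≤q)

p≤q⇒0≤q-p : ∀ {p q} → p ≤ q → 0ℚ ≤ q - p
p≤q⇒0≤q-p {p} {q} p≤q = subst (_≤ q - p) (+-inverseʳ p) (+-monoˡ-≤ (- p) p≤q)

ℕtoℚ-mono-≤ : ∀ {m n} → m ℕ.≤ n → ℕtoℚ m ≤ ℕtoℚ n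
ℕtoℚ-mono-≤ {m} m≤n with ℕ.m≤n⇒∃[o]m+o≡n m≤n
... | k , refl = subst (ℕtoℚ m ≤_) (sym (ℕtoℚ-+ m k)) (p≤p+q (0≤ℕtoℚ k))

≤-convex : ∀ {y} p q s {t} → 0ℚ ≤ t → t ≤ 1ℚ → y ≤ p + s → y ≤ q + s → y ≤ p · t + q · (1ℚ - t) + s
≤-convex {y} p q s {t} 0≤t t≤1 y≤p+s y≤q+s = begin
  y                                   ≡⟨ solve 2 (λ y t → y := y :* t :+ y :* (con 1ℚ :- t)) refl y t ⟩
  y · t + y · (1ℚ - t)                ≤⟨ +-mono-≤ (*-monoʳ-≤-nonNeg t {{nonNegative 0≤t}} y≤p+s)
                                                  (*-monoʳ-≤-nonNeg (1ℚ - t) {{nonNegative (p≤q⇒0≤q-p t≤1)}} y≤q+s) ⟩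
  (p + s) · t + (q + s) · (1ℚ - t)    ≡⟨ solve 4 (λ p q s t → (p :+ s) :* t :+ (q :+ s) :* (con 1ℚ :- t)
                                                  := p :* t :+ q :* (con 1ℚ :- t) :+ s) refl p q s t ⟩
  p · t + q · (1ℚ - t) + s ∎
  where
  open ≤-Reasoning
  open +-*-Solver

𝟙 : Bool → ℚ
𝟙 c = if c then 1ℚ else 0ℚ

𝟙-∧ : ∀ c d → 𝟙 (c ∧ d) ≡ (if c then 𝟙 d else 0ℚ)
𝟙-∧ true  d = refl
𝟙-∧ false d = refl

ℕtoℚ-𝟙+𝟙 : ∀ c d → ℕtoℚ ((if c then 1 else 0) ℕ.+ (if d then 1 else 0)) ≡ 𝟙 c + 𝟙 d
ℕtoℚ-𝟙+𝟙 true  true  = refl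
ℕtoℚ-𝟙+𝟙 true  false = refl
ℕtoℚ-𝟙+𝟙 false true  = refl
ℕtoℚ-𝟙+𝟙 false false = refl

*-distribˡ-if : ∀ p c q → p · (if c then q else 0ℚ) ≡ (if c then p · q else 0ℚ)
*-distribˡ-if p true  q = refl
*-distribˡ-if p false q = *-zeroʳ p

Σℚ≡sum : ∀ {k} (f : Fin k → ℚ) → Σℚ f ≡ sum f
Σℚ≡sum {ℕ.zero}  f = refl
Σℚ≡sum {ℕ.suc k} f = cong (f zero +_) (Σℚ≡sum (f ∘ suc))

ℕtoℚ-Σℕ : ∀ {k} (f : Fin k → ℕ) → ℕtoℚ (Σℕ f) ≡ sum (ℕtoℚ ∘ f)
ℕtoℚ-Σℕ {ℕ.zero}  f = refl
ℕtoℚ-Σℕ {ℕ.suc k} f = trans (ℕtoℚ-+ (f zero) _) (cong (ℕtoℚ (f zero) +_) (ℕtoℚ-Σℕ (f ∘ suc)))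

Σℕ-mono-≤ : ∀ {k} {f g : Fin k → ℕ} → (∀ i → f i ℕ.≤ g i) → Σℕ f ℕ.≤ Σℕ g
Σℕ-mono-≤ {ℕ.zero}  f≤g = ℕ.z≤n
Σℕ-mono-≤ {ℕ.suc k} f≤g = ℕ.+-mono-≤ (f≤g zero) (Σℕ-mono-≤ (f≤g ∘ suc))

sum-mono-≤ : ∀ {k} {f g : Fin k → ℚ} → (∀ i → f i ≤ g i) → sum f ≤ sum g
sum-mono-≤ {ℕ.zero}  f≤g = ≤-refl
sum-mono-≤ {ℕ.suc k} f≤g = +-mono-≤ (f≤g zero) (sum-mono-≤ (f≤g ∘ suc))

==-suc : ∀ {k} (a u : Fin k) → (suc a == suc u) ≡ (a == u)
==-suc a u with a Fin.≟ u
... | yes _ = refl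
... | no  _ = refl

sum-δ : ∀ {k} (a : Fin k) (f : Fin k → ℚ) → sum (λ u → if a == u then f u else 0ℚ) ≡ f a
sum-δ {ℕ.suc k} zero    f = trans (cong (f zero +_) (sum-replicate-zero k)) (+-identityʳ (f zero))
sum-δ {ℕ.suc k} (suc a) f = begin
  0ℚ + sum (λ u → if suc a == suc u then f (suc u) else 0ℚ)
    ≡⟨ +-identityˡ _ ⟩
  sum (λ u → if suc a == suc u then f (suc u) else 0ℚ)
    ≡⟨ sum-cong-≗ (λ u → cong (if_then f (suc u) else 0ℚ) (==-suc a u)) ⟩
  sum (λ u → if a == u then f (suc u) else 0ℚ)
    ≡⟨ sum-δ a (f ∘ suc) ⟩
  f (suc a) ∎
  where open ≡-Reasoning

incidence : ∀ {n m} (a b : Fin m → Fin n) (X Y : Fin m → Fin n → ℚ) → Fin n → Fin m → ℚ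
incidence a b X Y u e = (if a e == u then X e u else 0ℚ) + (if b e == u then Y e u else 0ℚ)

sum-incidence : ∀ {n m} (w : Fin n → ℚ) (a b : Fin m → Fin n) (X Y : Fin m → Fin n → ℚ) →
  sum (λ u → w u · sum (incidence a b X Y u)) ≡ sum (λ e → w (a e) · X e (a e) + w (b e) · Y e (b e))
sum-incidence {n} w a b X Y = begin
  sum (λ u → w u · sum (incidence a b X Y u))        ≡⟨ sum-cong-≗ (λ u → *-distribˡ-sum (w u) (incidence a b X Y u)) ⟩
  sum (λ u → sum (λ e → w u · incidence a b X Y u e)) ≡⟨ ∑-comm (λ u e → w u · incidence a b X Y u e) ⟩
  sum (λ e → sum (λ u → w u · incidence a b X Y u e)) ≡⟨ sum-cong-≗ at-both-ends ⟩
  sum (λ e → w (a e) · X e (a e) + w (b e) · Y e (b e)) ∎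
  where
  open ≡-Reasoning
  at-both-ends : ∀ e → sum (λ u → w u · incidence a b X Y u e) ≡ w (a e) · X e (a e) + w (b e) · Y e (b e)
  at-both-ends e = begin
    sum (λ u → w u · incidence a b X Y u e)
      ≡⟨ sum-cong-≗ (λ u → trans (*-distribˡ-+ (w u) _ _)
           (cong₂ _+_ (*-distribˡ-if (w u) (a e == u) _) (*-distribˡ-if (w u) (b e == u) _))) ⟩
    sum (λ u → at-a u + at-b u)           ≡⟨ ∑-distrib-+ at-a at-b ⟩
    sum at-a + sum at-b                   ≡⟨ cong₂ _+_ (sum-δ (a e) (λ u → w u · X e u))
                                                       (sum-δ (b e) (λ u → w u · Y e u)) ⟩
    w (a e) · X e (a e) + w (b e) · Y e (b e) ∎
    where
    at-a at-b : Fin n → ℚ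
    at-a u = if a e == u then w u · X e u else 0ℚ
    at-b u = if b e == u then w u · Y e u else 0ℚ

module _ {n m} (E : Graph n m) where

  src tgt : Fin m → Fin n
  src e = proj₁ (E e)
  tgt e = proj₂ (E e)

  degℚ : Fin n → ℚ
  degℚ u = ℕtoℚ (deg E u)

  0≤degℚ+degℚ : ∀ u v → 0ℚ ≤ degℚ u + degℚ v
  0≤degℚ+degℚ u v = +-mono-≤ (0≤ℕtoℚ (deg E u)) (0≤ℕtoℚ (deg E v))

  deg-incidence : ∀ u → degℚ u ≡ sum (incidence src tgt (λ _ _ → 1ℚ) (λ _ _ → 1ℚ) u)
  deg-incidence u =
    trans (ℕtoℚ-Σℕ (λ e → (if src e == u then 1 else 0) ℕ.+ (if tgt e == u then 1 else 0)))
          (sum-cong-≗ (λ e → ℕtoℚ-𝟙+𝟙 (src e == u) (tgt e == u)))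

  degAt-incidence : ∀ pos i u → ℕtoℚ (degAt E pos i u) ≡
    sum (incidence src tgt (λ e _ → 𝟙 (alive pos i (tgt e))) (λ e _ → 𝟙 (alive pos i (src e))) u)
  degAt-incidence pos i u = trans (ℕtoℚ-Σℕ summand) (sum-cong-≗ (λ e →
    trans (ℕtoℚ-𝟙+𝟙 (src e == u ∧ alive pos i (tgt e)) (tgt e == u ∧ alive pos i (src e)))
          (cong₂ _+_ (𝟙-∧ (src e == u) _) (𝟙-∧ (tgt e == u) _))))
    where
    summand : Fin m → ℕ
    summand e = (if src e == u ∧ alive pos i (tgt e) then 1 else 0)
            ℕ.+ (if tgt e == u ∧ alive pos i (src e) then 1 else 0)

  degAt≤deg : ∀ pos i u → degAt E pos i u ℕ.≤ deg E u
  degAt≤deg pos i u = Σℕ-mono-≤ (λ e →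
    ℕ.+-mono-≤ (𝟙ℕ-∧-≤ (src e == u) (alive pos i (tgt e))) (𝟙ℕ-∧-≤ (tgt e == u) (alive pos i (src e))))
    where
    𝟙ℕ-∧-≤ : ∀ c d → (if c ∧ d then 1 else 0) ℕ.≤ (if c then 1 else 0)
    𝟙ℕ-∧-≤ true  true  = ℕ.≤-refl
    𝟙ℕ-∧-≤ true  false = ℕ.z≤n
    𝟙ℕ-∧-≤ false d     = ℕ.z≤n

  sum-deg²≡sum-edge-deg : ℕtoℚ (Σℕ (λ u → deg E u * deg E u)) ≡ sum (λ e → degℚ (src e) + degℚ (tgt e))
  sum-deg²≡sum-edge-deg = begin
    ℕtoℚ (Σℕ (λ u → deg E u * deg E u))
      ≡⟨ ℕtoℚ-Σℕ (λ u → deg E u * deg E u) ⟩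
    sum (λ u → ℕtoℚ (deg E u * deg E u))
      ≡⟨ sum-cong-≗ (λ u → trans (ℕtoℚ-* (deg E u) (deg E u)) (cong (degℚ u ·_) (deg-incidence u))) ⟩
    sum (λ u → degℚ u · sum (incidence src tgt (λ _ _ → 1ℚ) (λ _ _ → 1ℚ) u))
      ≡⟨ sum-incidence degℚ src tgt (λ _ _ → 1ℚ) (λ _ _ → 1ℚ) ⟩
    sum (λ e → degℚ (src e) · 1ℚ + degℚ (tgt e) · 1ℚ)
      ≡⟨ sum-cong-≗ (λ e → cong₂ _+_ (*-identityʳ (degℚ (src e))) (*-identityʳ (degℚ (tgt e)))) ⟩
    sum (λ e → degℚ (src e) + degℚ (tgt e)) ∎
    where open ≡-Reasoning

  ⟪⟫-orientation : ∀ w d x → (∀ u → d u ≡ induced E x u) →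
    ⟪ w , d ⟫ ≡ sum (λ e → w (src e) · x e + w (tgt e) · (1ℚ - x e))
  ⟪⟫-orientation w d x d≡induced = begin
    ⟪ w , d ⟫                           ≡⟨ Σℚ≡sum (λ u → w u · d u) ⟩
    sum (λ u → w u · d u)               ≡⟨ sum-cong-≗ (λ u → cong (w u ·_) (d≡induced u)) ⟩
    sum (λ u → w u · induced E x u)     ≡⟨ sum-cong-≗ (λ u → cong (w u ·_) (Σℚ≡sum (at u))) ⟩
    sum (λ u → w u · sum (at u))        ≡⟨ sum-incidence w src tgt (λ e _ → x e) (λ e _ → 1ℚ - x e) ⟩
    sum (λ e → w (src e) · x e + w (tgt e) · (1ℚ - x e)) ∎
    where
    open ≡-Reasoning
    at : Fin n → Fin m → ℚ
    at = incidence src tgt (λ e _ → x e) (λ e _ → 1ℚ - x e)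

module _ {n m} (E : Graph n m) (w : Fin n → ℚ) (pos : Fin n → Fin n) where

  step : Fin n → ℕ
  step u = toℕ (pos u)

  charge : Fin n → Fin n → ℚ
  charge u v = w u · 𝟙 (alive pos (step u) v)

  ⟪w,greedyOut⟫≡sum-charge :
    ⟪ w , greedyOut E pos ⟫ ≡ sum (λ e → charge (src E e) (tgt E e) + charge (tgt E e) (src E e))
  ⟪w,greedyOut⟫≡sum-charge = begin
    ⟪ w , greedyOut E pos ⟫
      ≡⟨ Σℚ≡sum (λ u → w u · greedyOut E pos u) ⟩
    sum (λ u → w u · ℕtoℚ (degAt E pos (step u) u))
      ≡⟨ sum-cong-≗ (λ u → cong (w u ·_) (degAt-incidence E pos (step u) u)) ⟩
    sum (λ u → w u · sum (incidence (src E) (tgt E) tgt-alive src-alive u))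
      ≡⟨ sum-incidence w (src E) (tgt E) tgt-alive src-alive ⟩
    sum (λ e → charge (src E e) (tgt E e) + charge (tgt E e) (src E e)) ∎
    where
    open ≡-Reasoning
    tgt-alive src-alive : Fin m → Fin n → ℚ
    tgt-alive e u = 𝟙 (alive pos (step u) (tgt E e))
    src-alive e u = 𝟙 (alive pos (step u) (src E e))

  alive-if-≤ : ∀ {u v} → step u ℕ.≤ step v → alive pos (step u) v ≡ true
  alive-if-≤ {u} {v} u≤v = trans (isYes≗does (step u ℕ.≤? step v)) (dec-true (step u ℕ.≤? step v) u≤v)

  dead-if-< : ∀ {u v} → step v ℕ.< step u → alive pos (step u) v ≡ false
  dead-if-< {u} {v} v<u =
    trans (isYes≗does (step u ℕ.≤? step v)) (dec-false (step u ℕ.≤? step v) (ℕ.<⇒≱ v<u))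

  charge-first : ∀ {u v} → step u ℕ.< step v → charge u v + charge v u ≡ w u
  charge-first {u} {v} u<v = begin
    w u · 𝟙 (alive pos (step u) v) + w v · 𝟙 (alive pos (step v) u)
      ≡⟨ cong₂ (λ c d → w u · 𝟙 c + w v · 𝟙 d) (alive-if-≤ (ℕ.<⇒≤ u<v)) (dead-if-< u<v) ⟩
    w u · 1ℚ + w v · 0ℚ
      ≡⟨ cong₂ _+_ (*-identityʳ (w u)) (*-zeroʳ (w v)) ⟩
    w u + 0ℚ
      ≡⟨ +-identityʳ (w u) ⟩
    w u ∎
    where open ≡-Reasoning

  module _ (run : IsGreedyRun E w pos) where

    greedy-≤ : ∀ {u v} → step u ℕ.≤ step v → w u ≤ w v + degℚ E v
    greedy-≤ {u} {v} u≤v = begin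
      w u                                  ≤⟨ p≤p+q (0≤ℕtoℚ (degAt E pos (step u) u)) ⟩
      w u + ℕtoℚ (degAt E pos (step u) u)  ≤⟨ proj₂ run u v u≤v ⟩
      w v + ℕtoℚ (degAt E pos (step u) v)  ≤⟨ +-monoʳ-≤ (w v) (ℕtoℚ-mono-≤ (degAt≤deg E pos (step u) v)) ⟩
      w v + degℚ E v                       ∎
      where open ≤-Reasoning

    charge-≤ : ∀ {u v t} → u ≢ v → 0ℚ ≤ t → t ≤ 1ℚ →
      charge u v + charge v u ≤ w u · t + w v · (1ℚ - t) + (degℚ E u + degℚ E v)
    charge-≤ {u} {v} {t} u≢v 0≤t t≤1 with ℕ.<-cmp (step u) (step v)
    ... | tri< u<v _ _ = begin
      charge u v + charge v u ≡⟨ charge-first u<v ⟩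
      w u                     ≤⟨ ≤-convex (w u) (w v) (degℚ E u + degℚ E v) 0≤t t≤1 (p≤p+q (0≤degℚ+degℚ E u v))
                                   (≤-trans (greedy-≤ (ℕ.<⇒≤ u<v)) (+-monoʳ-≤ (w v) (p≤q+p (0≤ℕtoℚ (deg E u))))) ⟩
      w u · t + w v · (1ℚ - t) + (degℚ E u + degℚ E v) ∎
      where open ≤-Reasoning
    ... | tri≈ _ u≈v _ = contradiction (proj₁ run (toℕ-injective u≈v)) u≢v
    ... | tri> _ _ v<u = begin
      charge u v + charge v u ≡⟨ +-comm (charge u v) (charge v u) ⟩
      charge v u + charge u v ≡⟨ charge-first v<u ⟩
      w v                     ≤⟨ ≤-convex (w u) (w v) (degℚ E u + degℚ E v) 0≤t t≤1
                                   (≤-trans (greedy-≤ (ℕ.<⇒≤ v<u)) (+-monoʳ-≤ (w u) (p≤p+q (0≤ℕtoℚ (deg E v)))))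
                                   (p≤p+q (0≤degℚ+degℚ E u v)) ⟩
      w u · t + w v · (1ℚ - t) + (degℚ E u + degℚ E v) ∎
      where open ≤-Reasoning

lemma5 : ∀ {n m} (E : Graph n m) → Loopless E →
         (w : Fin n → ℚ) (pos : Fin n → Fin n) → IsGreedyRun E w pos →
         (dstar : Fin n → ℚ) → IsOrientation E dstar →
         (∀ d → IsOrientation E d → ⟪ w , dstar ⟫ ≤ ⟪ w , d ⟫) →
         ⟪ w , greedyOut E pos ⟫ ≤ ⟪ w , dstar ⟫ + ℕtoℚ (Σℕ (λ u → deg E u * deg E u))
-- The bound holds against every orientation.
lemma5 {n} {m} E loopless w pos run dstar (x , x-valid , dstar≡induced) _ = begin
  ⟪ w , greedyOut E pos ⟫
    ≡⟨ ⟪w,greedyOut⟫≡sum-charge E w pos ⟩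
  sum (λ e → charge E w pos (src E e) (tgt E e) + charge E w pos (tgt E e) (src E e))
    ≤⟨ sum-mono-≤ (λ e → charge-≤ E w pos run (loopless e) (proj₁ (x-valid e)) (proj₂ (x-valid e))) ⟩
  sum (λ e → cost e + end-degrees e)
    ≡⟨ ∑-distrib-+ cost end-degrees ⟩
  sum cost + sum end-degrees
    ≡⟨ cong₂ _+_ (sym (⟪⟫-orientation E w dstar x dstar≡induced)) (sym (sum-deg²≡sum-edge-deg E)) ⟩
  ⟪ w , dstar ⟫ + ℕtoℚ (Σℕ (λ u → deg E u * deg E u)) ∎
  where
  open ≤-Reasoning
  cost end-degrees : Fin m → ℚ
  cost e = w (src E e) · x e + w (tgt E e) · (1ℚ - x e)
  end-degrees e = degℚ E (src E e) + degℚ E (tgt E e)
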